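{- Let $1\le p_1\le\cdots\le p_d\le n$ be integers, and let $G_0=G_0(p_1,\ldots,p_d)$ be the $d$-uniform $d$-partite hypergraph with vertex classes $V_1,\ldots,V_d$, each consisting of $n$ vertices labeled $1,\ldots,n$, with edges identified with tuples $(x_1,\ldots,x_d)\in[n]^d$, in which $(x_1,\ldots,x_d)$ is NOT an edge of $G_0$ if and only if $x_{(i)}\ge p_i$ for every $1\le i\le d$. Then $W_n(p_1,\ldots,p_d)\ge \|G_0\|$, where $\|G_0\|$ denotes the number of edges of $G_0$.
   Context: $x_{(i)}$ denotes the $i$-th smallest entry of $x$ when its entries are sorted with repetitions. A $d$-uniform $d$-partite hypergraph has vertex classes $V_1,\ldots,V_d$ and edges that contain exactly one vertex from each class; only such crossing $d$-sets are considered as potential edges. $K^d_{p_1,\ldots,p_d}$ is the complete $d$-uniform $d$-partite hypergraph with classes of sizes $p_1,\ldots,p_d$; a copy of it is given by sets $S_i\subseteq V_i$ with $|S_i|=p_{\pi(i)}$ for some permutation $\pi$ of $[d]$ such that all crossing $d$-sets within $\bigcup S_i$ are edges. A hypergraph is weakly $K^d_{p_1,\ldots,p_d}$-saturated if its non-edges can be added one at a time in some order so that each added edge creates a new copy of $K^d_{p_1,\ldots,p_d}$ (containing that edge). $W_n(p_1,\ldots,p_d)$ is the minimum number of edges of a weakly $K^d_{p_1,\ldots,p_d}$-saturated $d$-uniform $d$-partite hypergraph with $n$ vertices in each class. -}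

module Defs where

open import Data.Bool using (Bool; true; false; not; _∧_)
open import Data.Nat using (ℕ; zero; suc; _≤ᵇ_; _≤_)
open import Data.Nat.Properties using (≤-decTotalOrder)
open import Data.Fin using (Fin; toℕ)
open import Data.Fin.Subset using (Subset; _∈_; ∣_∣)
open import Data.Fin.Permutation using (Permutation′; _⟨$⟩ʳ_)
open import Data.Vec using (Vec; []; _∷_; lookup; toList)
import Data.Vec as Vec
open import Data.List using (List; []; _∷_; _++_; length; filterᵇ; concatMap)
open import Data.List.Sort ≤-decTotalOrder using (sort)
import Data.List.Membership.Propositional as LM
open import Data.List.Relation.Unary.Unique.Propositional using (Unique)
open import Data.Product using (Σ; _×_; ∃)
open import Data.Sum using (_⊎_)
open import Data.Fin using () renaming (_≤_ to _≤ᶠ_)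
open import Data.List using (allFin)
open import Function.Bundles using (_⇔_)
open import Relation.Binary.PropositionalEquality using (_≡_)

-- A potential edge of a d-uniform d-partite hypergraph with n vertices in
-- each class: one vertex (in Fin n, i.e. label toℕ x + 1) from each class.
Tuple : ℕ → ℕ → Set
Tuple n d = Vec (Fin n) d

allTuples : (n d : ℕ) → List (Tuple n d)
allTuples n zero    = [] ∷ []
allTuples n (suc d) = concatMap (λ x → Data.List.map (x ∷_) (allTuples n d)) (allFin n)

Hypergraph : ℕ → ℕ → Set
Hypergraph n d = Tuple n d → Bool

numEdges : ∀ {n d} → Hypergraph n d → ℕ
numEdges {n} {d} H = length (filterᵇ H (allTuples n d))

-- A copy of K^d_{p_1..p_d} in the hypergraph with edge predicate E,
-- containing the crossing tuple e: sets S_i ⊆ V_i with |S_i| = p_{π(i)}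
-- for a permutation π, all crossing tuples within ⋃ S_i are edges.
CopyContaining : ∀ {n d} → Vec ℕ d → (Tuple n d → Set) → Tuple n d → Set
CopyContaining {n} {d} p E e =
  Σ (Permutation′ d) λ π → Σ (Fin d → Subset n) λ S →
    (∀ i → ∣ S i ∣ ≡ lookup p (π ⟨$⟩ʳ i))
    × (∀ (x : Tuple n d) → (∀ i → lookup x i ∈ S i) → E x)
    × (∀ i → lookup e i ∈ S i)

-- Weak K^d_{p}-saturation: the non-edges of H can be listed (each exactly
-- once) as L such that adding them in order, each added edge e creates a
-- copy of K^d_p containing e (in H plus e plus the earlier added edges).
WeaklySaturated : ∀ {n d} → Vec ℕ d → Hypergraph n d → Set
WeaklySaturated {n} {d} p H =
  Σ (List (Tuple n d)) λ L →
    Unique L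
    × (∀ x → (x LM.∈ L) ⇔ (H x ≡ false))
    × (∀ ys e zs → L ≡ ys ++ (e ∷ zs) →
         CopyContaining p (λ x → (H x ≡ true) ⊎ (x LM.∈ (e ∷ ys))) e)

label : ∀ {n} → Fin n → ℕ
label x = suc (toℕ x)

allGeq : List ℕ → List ℕ → Bool
allGeq []       []       = true
allGeq (a ∷ as) (q ∷ qs) = (q ≤ᵇ a) ∧ allGeq as qs
allGeq _        _        = false

-- (x_1..x_d) is a non-edge of G_0 iff x_(i) ≥ p_i for all i, where
-- x_(i) is the i-th entry of the sorted (with repetitions) list of labels.
G0 : ∀ {n d} → Vec ℕ d → Hypergraph n d
G0 p x = not (allGeq (sort (toList (Vec.map label x))) (toList p))

ValidParams : (n d : ℕ) → Vec ℕ d → Set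
ValidParams n d p =
  (∀ i → 1 ≤ lookup p i) × (∀ i → lookup p i ≤ n)
  × (∀ i j → i ≤ᶠ j → lookup p i ≤ lookup p j)

module Submission where

-- The polynomial method. Put the vertices 1, …, n of every class at 0, …, n − 1 ∈ ℚ and attach to each
-- edge x of G₀ the monomial Π_i X_i^(x_i − 1). If ‖H‖ < ‖G₀‖, linear algebra yields a nontrivial
-- combination f of these monomials vanishing on all edges of H. When the saturation process adds an
-- edge e creating a copy of K_p with sides S_1, …, S_d, the iterated divided difference of f over the
-- grid S_1 × ⋯ × S_d is a nonzero multiple of f(e) provided f vanishes on the rest of the grid. It also
-- kills every monomial whose degree in some coordinate i is below |S_i| − 1, and the definition of G₀
-- says exactly that every monomial of f is of this kind. So f vanishes along the whole process, hence
-- on all of [n]^d. But for a monomial X^b of maximal degree in the support of f, the divided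
-- difference over the grid Π_i {0, …, b_i} isolates its coefficient: a contradiction.

open import Defs
open import Algebra.Bundles using (CommutativeRing)

open import Data.Bool using (true; false; not)
open import Data.Bool.Properties using (T-≡)
open import Data.Empty using (⊥-elim)
open import Data.Fin as Fin using (Fin; zero; suc; toℕ; inject≤; cast) renaming (_≤_ to _≤ᶠ_)
import Data.Fin.Properties as Fin
open import Data.Fin.Permutation using (Permutation; Permutation′; _⟨$⟩ʳ_; _⟨$⟩ˡ_; inverseˡ)
open import Data.Fin.Subset as Subset using (Subset; ∣_∣)
import Data.Integer as ℤ
import Data.Integer.Properties as ℤ
open import Data.List as List using (List; []; _∷_; _++_; [_]; length; tabulate; allFin; cartesianProductWith; filterᵇ)
import Data.List.Properties as List
open import Data.List.Membership.Propositional using (_∈_; find)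
import Data.List.Membership.Propositional.Properties as ∈
open import Data.List.Relation.Binary.Permutation.Propositional using (↭⇒↭ₛ)
import Data.List.Relation.Binary.Permutation.Setoid as Perm
import Data.List.Relation.Binary.Permutation.Setoid.Properties as Perm
open import Data.List.Relation.Unary.All as All using (All; []; _∷_; all?)
open import Data.List.Relation.Unary.All.Properties using (¬All⇒Any¬; map⁻; ++⁺; ++⁻)
open import Data.List.Relation.Unary.AllPairs using ([]; _∷_)
open import Data.List.Relation.Unary.Any using (here; there)
open import Data.List.Relation.Unary.Sorted.TotalOrder.Properties using (lookup-mono-≤)
open import Data.List.Relation.Unary.Unique.Propositional using (Unique)
import Data.List.Relation.Unary.Unique.Propositional.Properties as Unique
open import Data.Nat as ℕ using (ℕ; zero; suc; _∸_; _≤_; _<_; _≤ᵇ_; _≤?_; z≤n; s≤s)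
import Data.Nat.Coprimality as Coprime
import Data.Nat.Properties as ℕ
open import Data.Nat.Properties using (≤-decTotalOrder)
open import Data.List.Sort ≤-decTotalOrder using (sort; sort-↭; sort-↗)
open import Data.Product using (∃; _×_; _,_; proj₁; proj₂)
open import Data.Rational using (ℚ; mkℚ; ↥_; 0ℚ; 1ℚ; _+_; _*_; _-_; -_; 1/_; ≢-nonZero; +-*-rawSemiring)
open import Data.Rational.Properties
  using ( _≟_; 1≢0; *-comm; *-assoc; *-distribʳ-+; *-identityˡ; *-identityʳ; *-zeroˡ; *-zeroʳ; *-inverseˡ
        ; +-identityˡ; +-identityʳ; +-0-group; +-*-commutativeRing)
open import Data.Rational.Solver using (module +-*-Solver)
open import Algebra.Definitions.RawSemiring +-*-rawSemiring using (_^_)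
open import Algebra.Properties.Group +-0-group using (x∙y⁻¹≈ε⇒x≈y)
open import Algebra.Properties.Semiring.Sum (CommutativeRing.semiring +-*-commutativeRing)
  using (sum-syntax; sum-cong-≗; sum-replicate-zero; sum-remove; ∑-distrib-+; *-distribˡ-sum)
open import Data.Sum using (inj₁; inj₂)
open import Data.Vec as Vec using (Vec; []; _∷_; lookup; toList)
import Data.Vec.Properties as Vec
open import Function using (_∘_)
open import Function.Bundles using (Equivalence)
open import Relation.Binary.Bundles using (DecTotalOrder)
open import Relation.Binary.PropositionalEquality as ≡
  using (_≡_; _≢_; refl; sym; trans; cong; cong₂; subst; module ≡-Reasoning)
open import Relation.Nullary using (¬_; ¬?; Dec; yes; no)
open import Relation.Nullary.Decidable using (T?)
open import Relation.Unary using (Decidable)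

open +-*-Solver

-- Junk value: 0 ⁻¹ = 0.
infix 10 _⁻¹
_⁻¹ : ℚ → ℚ
p ⁻¹ with p ≟ 0ℚ
... | yes _  = 0ℚ
... | no p≢0 = 1/_ p {{≢-nonZero p≢0}}

⁻¹-inverseˡ : ∀ {p} → p ≢ 0ℚ → p ⁻¹ * p ≡ 1ℚ
⁻¹-inverseˡ {p} p≢0 with p ≟ 0ℚ
... | yes p≡0 = ⊥-elim (p≢0 p≡0)
... | no p≢0′ = *-inverseˡ p {{≢-nonZero p≢0′}}

⁻¹-inverseʳ : ∀ {p} → p ≢ 0ℚ → p * p ⁻¹ ≡ 1ℚ
⁻¹-inverseʳ {p} p≢0 = trans (*-comm p (p ⁻¹)) (⁻¹-inverseˡ p≢0)

*-cancelˡ-≡0 : ∀ {p q} → p ≢ 0ℚ → p * q ≡ 0ℚ → q ≡ 0ℚ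
*-cancelˡ-≡0 {p} {q} p≢0 pq≡0 = begin
  q              ≡⟨ sym (*-identityˡ q) ⟩
  1ℚ * q         ≡⟨ cong (_* q) (sym (⁻¹-inverseˡ p≢0)) ⟩
  p ⁻¹ * p * q   ≡⟨ *-assoc (p ⁻¹) p q ⟩
  p ⁻¹ * (p * q) ≡⟨ cong (p ⁻¹ *_) pq≡0 ⟩
  p ⁻¹ * 0ℚ      ≡⟨ *-zeroʳ (p ⁻¹) ⟩
  0ℚ             ∎
  where open ≡-Reasoning

*-≢0 : ∀ {p q} → p ≢ 0ℚ → q ≢ 0ℚ → p * q ≢ 0ℚ
*-≢0 p≢0 q≢0 pq≡0 = q≢0 (*-cancelˡ-≡0 p≢0 pq≡0)

⁻¹-≢0 : ∀ {p} → p ≢ 0ℚ → p ⁻¹ ≢ 0ℚ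
⁻¹-≢0 {p} p≢0 p⁻¹≡0 = 1≢0 (trans (sym (⁻¹-inverseˡ p≢0)) (trans (cong (_* p) p⁻¹≡0) (*-zeroˡ p)))

⁻¹-unique : ∀ {p r} → p * r ≡ 1ℚ → p ⁻¹ ≡ r
⁻¹-unique {p} {r} pr≡1 = begin
  p ⁻¹            ≡⟨ sym (*-identityʳ (p ⁻¹)) ⟩
  p ⁻¹ * 1ℚ       ≡⟨ cong (p ⁻¹ *_) (sym pr≡1) ⟩
  p ⁻¹ * (p * r)  ≡⟨ sym (*-assoc (p ⁻¹) p r) ⟩
  p ⁻¹ * p * r    ≡⟨ cong (_* r) (⁻¹-inverseˡ p≢0) ⟩
  1ℚ * r          ≡⟨ *-identityˡ r ⟩
  r               ∎
  where
  open ≡-Reasoning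
  p≢0 : p ≢ 0ℚ
  p≢0 p≡0 = 1≢0 (trans (sym pr≡1) (trans (cong (_* r) p≡0) (*-zeroˡ r)))

⁻¹-distrib-* : ∀ p q → (p * q) ⁻¹ ≡ p ⁻¹ * q ⁻¹
⁻¹-distrib-* p q = by-cases (p ≟ 0ℚ) (q ≟ 0ℚ)
  where
  open ≡-Reasoning
  by-cases : Dec (p ≡ 0ℚ) → Dec (q ≡ 0ℚ) → (p * q) ⁻¹ ≡ p ⁻¹ * q ⁻¹
  by-cases (yes refl) _          = trans (cong _⁻¹ (*-zeroˡ q)) (sym (*-zeroˡ (q ⁻¹)))
  by-cases (no _)     (yes refl) = trans (cong _⁻¹ (*-zeroʳ p)) (sym (*-zeroʳ (p ⁻¹)))
  by-cases (no p≢0)   (no q≢0)   = ⁻¹-unique {p * q} (begin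
    p * q * (p ⁻¹ * q ⁻¹)  ≡⟨ solve 4 (λ p q p' q' → p :* q :* (p' :* q') := (p :* p') :* (q :* q')) refl p q (p ⁻¹) (q ⁻¹) ⟩
    p * p ⁻¹ * (q * q ⁻¹)  ≡⟨ cong₂ _*_ (⁻¹-inverseʳ p≢0) (⁻¹-inverseʳ q≢0) ⟩
    1ℚ                     ∎)

p-q≡0⇒p≡q : ∀ {p q} → p - q ≡ 0ℚ → p ≡ q
p-q≡0⇒p≡q {p} {q} = x∙y⁻¹≈ε⇒x≈y p q

p≡0⇒p*q≡0 : ∀ {p} q → p ≡ 0ℚ → p * q ≡ 0ℚ
p≡0⇒p*q≡0 q refl = *-zeroˡ q

record IsLinear {X : Set} (L : (X → ℚ) → ℚ) : Set where
  field
    cong-≗ : ∀ {f g} → (∀ x → f x ≡ g x) → L f ≡ L g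
    +-homo : ∀ f g → L (λ x → f x + g x) ≡ L f + L g
    *-homo : ∀ a f → L (λ x → a * f x) ≡ a * L f

  0-homo : L (λ _ → 0ℚ) ≡ 0ℚ
  0-homo = trans (*-homo 0ℚ (λ _ → 0ℚ)) (*-zeroˡ (L (λ _ → 0ℚ)))

  ∑-homo : ∀ {k} (c : Fin k → ℚ) (f : Fin k → X → ℚ) →
           L (λ x → ∑[ j < k ] (c j * f j x)) ≡ ∑[ j < k ] (c j * L (f j))
  ∑-homo {zero}  c f = 0-homo
  ∑-homo {suc k} c f = begin
    L (λ x → c zero * f zero x + ∑[ j < k ] (c (suc j) * f (suc j) x))
      ≡⟨ +-homo _ _ ⟩
    L (λ x → c zero * f zero x) + L (λ x → ∑[ j < k ] (c (suc j) * f (suc j) x))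
      ≡⟨ cong₂ _+_ (*-homo (c zero) (f zero)) (∑-homo (c ∘ suc) (f ∘ suc)) ⟩
    c zero * L (f zero) + ∑[ j < k ] (c (suc j) * L (f (suc j)))  ∎
    where open ≡-Reasoning

  -‿homo : ∀ f g → L (λ x → f x - g x) ≡ L f - L g
  -‿homo f g = begin
    L (λ x → f x - g x)              ≡⟨ cong-≗ (λ x → solve 2 (λ a b → a :- b := a :+ con (- 1ℚ) :* b) refl (f x) (g x)) ⟩
    L (λ x → f x + - 1ℚ * g x)       ≡⟨ +-homo f _ ⟩
    L f + L (λ x → - 1ℚ * g x)       ≡⟨ cong (L f +_) (*-homo (- 1ℚ) g) ⟩
    L f + - 1ℚ * L g                 ≡⟨ solve 2 (λ a b → a :+ con (- 1ℚ) :* b := a :- b) refl (L f) (L g) ⟩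
    L f - L g                        ∎
    where open ≡-Reasoning

module DividedDifferences {A : Set} (ν : A → ℚ) (ν-injective : ∀ {x y} → ν x ≡ ν y → x ≡ y) where

  ν-≢ : ∀ {x y} → x ≢ y → ν x - ν y ≢ 0ℚ
  ν-≢ x≢y = x≢y ∘ ν-injective ∘ p-q≡0⇒p≡q

  nodeProduct : A → List A → ℚ
  nodeProduct c []      = 1ℚ
  nodeProduct c (y ∷ T) = (ν c - ν y) * nodeProduct c T

  nodeProduct-≢0 : ∀ {c} T → All (c ≢_) T → nodeProduct c T ≢ 0ℚ
  nodeProduct-≢0 []      []           = λ ()
  nodeProduct-≢0 (y ∷ T) (c≢y ∷ c∉T) = *-≢0 (ν-≢ c≢y) (nodeProduct-≢0 T c∉T)

  -- Unfolded, divDiff g S = Σ_{x ∈ S} g x / Π_{y ∈ S, y ≠ x} (ν x − ν y): the divided difference of g at S.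
  divDiff : (A → ℚ) → List A → ℚ
  divDiff g []      = 0ℚ
  divDiff g (c ∷ T) = g c * (nodeProduct c T) ⁻¹ + divDiff (λ x → g x * (ν x - ν c) ⁻¹) T

  divDiff-cong : ∀ {g h} S → All (λ x → g x ≡ h x) S → divDiff g S ≡ divDiff h S
  divDiff-cong []      []                = refl
  divDiff-cong (c ∷ T) (gc≡hc ∷ g≡h) =
    cong₂ _+_ (cong (_* (nodeProduct c T) ⁻¹) gc≡hc)
              (divDiff-cong T (All.map (λ {x} gx≡hx → cong (_* (ν x - ν c) ⁻¹) gx≡hx) g≡h))

  divDiff-+ : ∀ g h S → divDiff (λ x → g x + h x) S ≡ divDiff g S + divDiff h S
  divDiff-+ g h []      = refl
  divDiff-+ g h (c ∷ T) = begin
    (g c + h c) * w + divDiff (λ x → (g x + h x) * (ν x - ν c) ⁻¹) T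
      ≡⟨ cong ((g c + h c) * w +_) (trans (divDiff-cong T (All.tabulate λ {x} _ → *-distribʳ-+ ((ν x - ν c) ⁻¹) (g x) (h x)))
                                           (divDiff-+ g′ h′ T)) ⟩
    (g c + h c) * w + (divDiff g′ T + divDiff h′ T)
      ≡⟨ solve 5 (λ a b i u v → (a :+ b) :* i :+ (u :+ v) := (a :* i :+ u) :+ (b :* i :+ v)) refl (g c) (h c) w (divDiff g′ T) (divDiff h′ T) ⟩
    (g c * w + divDiff g′ T) + (h c * w + divDiff h′ T)  ∎
    where
    open ≡-Reasoning
    w  = (nodeProduct c T) ⁻¹
    g′ = λ x → g x * (ν x - ν c) ⁻¹
    h′ = λ x → h x * (ν x - ν c) ⁻¹

  divDiff-* : ∀ a g S → divDiff (λ x → a * g x) S ≡ a * divDiff g S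
  divDiff-* a g []      = sym (*-zeroʳ a)
  divDiff-* a g (c ∷ T) = begin
    a * g c * w + divDiff (λ x → a * g x * (ν x - ν c) ⁻¹) T
      ≡⟨ cong (a * g c * w +_) (trans (divDiff-cong T (All.tabulate λ {x} _ → *-assoc a (g x) _)) (divDiff-* a g′ T)) ⟩
    a * g c * w + a * divDiff g′ T
      ≡⟨ solve 4 (λ a b i u → a :* b :* i :+ a :* u := a :* (b :* i :+ u)) refl a (g c) w (divDiff g′ T) ⟩
    a * (g c * w + divDiff g′ T)  ∎
    where
    open ≡-Reasoning
    w  = (nodeProduct c T) ⁻¹
    g′ = λ x → g x * (ν x - ν c) ⁻¹

  divDiff-isLinear : ∀ S → IsLinear (λ g → divDiff g S)
  divDiff-isLinear S = record
    { cong-≗ = λ f≗g → divDiff-cong S (All.tabulate λ {x} _ → f≗g x)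
    ; +-homo = λ f g → divDiff-+ f g S
    ; *-homo = λ a f → divDiff-* a f S
    }

  divDiff-vanishing : ∀ {g} S → All (λ x → g x ≡ 0ℚ) S → divDiff g S ≡ 0ℚ
  divDiff-vanishing S g≡0 = trans (divDiff-cong S g≡0) (IsLinear.0-homo (divDiff-isLinear S))

  divDiff-swap : ∀ g c e U → divDiff g (c ∷ e ∷ U) ≡ divDiff g (e ∷ c ∷ U)
  divDiff-swap g c e U = begin
    g c * ((ν c - ν e) * nodeProduct c U) ⁻¹ + (g e * [e-c] * wₑ + divDiff (λ x → g x * [x-c] x * [x-e] x) U)
      ≡⟨ cong₂ _+_ (cong (g c *_) (⁻¹-distrib-* (ν c - ν e) (nodeProduct c U)))
                   (cong (g e * [e-c] * wₑ +_) (divDiff-cong U (All.tabulate λ {x} _ →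
                     solve 3 (λ a b c → a :* b :* c := a :* c :* b) refl (g x) ([x-c] x) ([x-e] x)))) ⟩
    g c * ([c-e] * w꜀) + (g e * [e-c] * wₑ + r)
      ≡⟨ solve 7 (λ gc a b ge e f r → gc :* (a :* b) :+ (ge :* e :* f :+ r) := ge :* (e :* f) :+ (gc :* a :* b :+ r))
                 refl (g c) [c-e] w꜀ (g e) [e-c] wₑ r ⟩
    g e * ([e-c] * wₑ) + (g c * [c-e] * w꜀ + r)
      ≡⟨ cong (_+ (g c * [c-e] * w꜀ + r)) (cong (g e *_) (sym (⁻¹-distrib-* (ν e - ν c) (nodeProduct e U)))) ⟩
    g e * ((ν e - ν c) * nodeProduct e U) ⁻¹ + (g c * [c-e] * w꜀ + r)  ∎
    where
    open ≡-Reasoning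
    [x-c] = λ x → (ν x - ν c) ⁻¹
    [x-e] = λ x → (ν x - ν e) ⁻¹
    [c-e] = (ν c - ν e) ⁻¹
    [e-c] = (ν e - ν c) ⁻¹
    w꜀ = (nodeProduct c U) ⁻¹
    wₑ = (nodeProduct e U) ⁻¹
    r = divDiff (λ x → g x * [x-e] x * [x-c] x) U

  divDiff-removeNode : ∀ g c T → All (c ≢_) T → divDiff (λ x → (ν x - ν c) * g x) (c ∷ T) ≡ divDiff g T
  divDiff-removeNode g c T c∉T = begin
    (ν c - ν c) * g c * (nodeProduct c T) ⁻¹ + divDiff (λ x → (ν x - ν c) * g x * (ν x - ν c) ⁻¹) T
      ≡⟨ cong₂ _+_ (solve 3 (λ a b i → (a :- a) :* b :* i := con 0ℚ) refl (ν c) (g c) ((nodeProduct c T) ⁻¹))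
                   (divDiff-cong T (All.map (λ c≢x → cancel (ν-≢ (c≢x ∘ sym))) c∉T)) ⟩
    0ℚ + divDiff g T  ≡⟨ +-identityˡ _ ⟩
    divDiff g T       ∎
    where
    open ≡-Reasoning
    cancel : ∀ {x} → ν x - ν c ≢ 0ℚ → (ν x - ν c) * g x * (ν x - ν c) ⁻¹ ≡ g x
    cancel {x} x-c≢0 = begin
      (ν x - ν c) * g x * (ν x - ν c) ⁻¹   ≡⟨ solve 3 (λ a b i → a :* b :* i := b :* (a :* i)) refl (ν x - ν c) (g x) ((ν x - ν c) ⁻¹) ⟩
      g x * ((ν x - ν c) * (ν x - ν c) ⁻¹) ≡⟨ cong (g x *_) (⁻¹-inverseʳ x-c≢0) ⟩
      g x * 1ℚ                             ≡⟨ *-identityʳ (g x) ⟩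
      g x                                  ∎

  δ₀ : ℕ → ℚ
  δ₀ zero    = 1ℚ
  δ₀ (suc _) = 0ℚ

  -- ν e − ν c = (ν x − ν c) − (ν x − ν e); dividing out the node c, resp. e, leaves m + 1 nodes.
  divDiff-1 : ∀ m S → length S ≡ suc m → Unique S → divDiff (λ _ → 1ℚ) S ≡ δ₀ m
  divDiff-1 zero    (c ∷ [])    refl _ = refl
  divDiff-1 (suc m) (c ∷ e ∷ U) |S|≡2+m ((c≢e ∷ c∉U) ∷ (e∉U ∷ U!)) =
    *-cancelˡ-≡0 (ν-≢ (c≢e ∘ sym)) (begin
      (ν e - ν c) * divDiff 𝟙 (c ∷ e ∷ U)
        ≡⟨ sym (divDiff-* (ν e - ν c) 𝟙 (c ∷ e ∷ U)) ⟩
      divDiff (λ _ → (ν e - ν c) * 1ℚ) (c ∷ e ∷ U)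
        ≡⟨ divDiff-cong (c ∷ e ∷ U) (All.tabulate λ {x} _ →
             solve 3 (λ c e x → (e :- c) :* con 1ℚ := (x :- c) :* con 1ℚ :- (x :- e) :* con 1ℚ) refl (ν c) (ν e) (ν x)) ⟩
      divDiff (λ x → (ν x - ν c) * 1ℚ - (ν x - ν e) * 1ℚ) (c ∷ e ∷ U)
        ≡⟨ IsLinear.-‿homo (divDiff-isLinear (c ∷ e ∷ U)) (λ x → (ν x - ν c) * 1ℚ) (λ x → (ν x - ν e) * 1ℚ) ⟩
      divDiff (λ x → (ν x - ν c) * 1ℚ) (c ∷ e ∷ U) - divDiff (λ x → (ν x - ν e) * 1ℚ) (c ∷ e ∷ U)
        ≡⟨ cong₂ _-_ (divDiff-removeNode 𝟙 c (e ∷ U) (c≢e ∷ c∉U))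
                     (trans (divDiff-swap (λ x → (ν x - ν e) * 1ℚ) c e U) (divDiff-removeNode 𝟙 e (c ∷ U) ((c≢e ∘ sym) ∷ e∉U))) ⟩
      divDiff 𝟙 (e ∷ U) - divDiff 𝟙 (c ∷ U)
        ≡⟨ cong₂ _-_ (divDiff-1 m (e ∷ U) |U|+1≡1+m (e∉U ∷ U!)) (divDiff-1 m (c ∷ U) |U|+1≡1+m (c∉U ∷ U!)) ⟩
      δ₀ m - δ₀ m
        ≡⟨ solve 1 (λ a → a :- a := con 0ℚ) refl (δ₀ m) ⟩
      0ℚ  ∎)
    where
    open ≡-Reasoning
    𝟙 : A → ℚ
    𝟙 _ = 1ℚ
    |U|+1≡1+m : suc (length U) ≡ suc m
    |U|+1≡1+m = ℕ.suc-injective |S|≡2+m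

  δ₀-suc : ∀ a b → b < a → δ₀ (a ∸ b) ≡ 0ℚ
  δ₀-suc (suc a) zero    _         = refl
  δ₀-suc (suc a) (suc b) (s≤s b<a) = δ₀-suc a b b<a

  divDiff-^ : ∀ k S → Unique S → suc k ≤ length S → divDiff (λ x → ν x ^ k) S ≡ δ₀ (length S ∸ suc k)
  divDiff-^ zero    (c ∷ T) S! _ = divDiff-1 (length T) (c ∷ T) refl S!
  divDiff-^ (suc k) (c ∷ T) S!@(c∉T ∷ T!) (s≤s k<|T|) = begin
    divDiff (λ x → ν x * g x) (c ∷ T)
      ≡⟨ divDiff-cong (c ∷ T) (All.tabulate λ {x} _ → solve 3 (λ x c g → x :* g := (x :- c) :* g :+ c :* g) refl (ν x) (ν c) (g x)) ⟩
    divDiff (λ x → (ν x - ν c) * g x + ν c * g x) (c ∷ T)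
      ≡⟨ divDiff-+ (λ x → (ν x - ν c) * g x) (λ x → ν c * g x) (c ∷ T) ⟩
    divDiff (λ x → (ν x - ν c) * g x) (c ∷ T) + divDiff (λ x → ν c * g x) (c ∷ T)
      ≡⟨ cong₂ _+_ (divDiff-removeNode g c T c∉T) (divDiff-* (ν c) g (c ∷ T)) ⟩
    divDiff g T + ν c * divDiff g (c ∷ T)
      ≡⟨ cong₂ _+_ (divDiff-^ k T T! k<|T|)
                   (cong (ν c *_) (trans (divDiff-^ k (c ∷ T) S! (ℕ.m≤n⇒m≤1+n k<|T|)) (δ₀-suc (length T) k k<|T|))) ⟩
    δ₀ (length T ∸ suc k) + ν c * 0ℚ
      ≡⟨ solve 2 (λ a c → a :+ c :* con 0ℚ := a) refl (δ₀ (length T ∸ suc k)) (ν c) ⟩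
    δ₀ (length T ∸ suc k)  ∎
    where
    open ≡-Reasoning
    g = λ x → ν x ^ k

  divDiff-^-vanishes : ∀ k S → Unique S → suc k < length S → divDiff (λ x → ν x ^ k) S ≡ 0ℚ
  divDiff-^-vanishes k S S! k+1<|S| = trans (divDiff-^ k S S! (ℕ.<⇒≤ k+1<|S|)) (δ₀-suc (length S) (suc k) k+1<|S|)

  divDiff-^-leading : ∀ k S → Unique S → length S ≡ suc k → divDiff (λ x → ν x ^ k) S ≡ 1ℚ
  divDiff-^-leading k S S! |S|≡k+1 =
    trans (divDiff-^ k S S! (ℕ.≤-reflexive (sym |S|≡k+1)))
          (cong δ₀ (trans (cong (_∸ suc k) |S|≡k+1) (ℕ.n∸n≡0 (suc k))))

  divDiff-isolated : ∀ g S {e} → Unique S → e ∈ S → All (λ x → x ≢ e → g x ≡ 0ℚ) S →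
                     ∃ λ ω → ω ≢ 0ℚ × divDiff g S ≡ g e * ω
  divDiff-isolated g (c ∷ T) (c∉T ∷ _) (here refl) (_ ∷ g≡0) =
    (nodeProduct c T) ⁻¹ , ⁻¹-≢0 (nodeProduct-≢0 T c∉T) ,
    trans (cong (g c * (nodeProduct c T) ⁻¹ +_)
                (divDiff-vanishing T (All.zipWith (λ {x} (gx≡0 , c≢x) → p≡0⇒p*q≡0 ((ν x - ν c) ⁻¹) (gx≡0 (c≢x ∘ sym)))
                                                  (g≡0 , c∉T))))
          (+-identityʳ _)
  divDiff-isolated g (c ∷ T) {e} (c∉T ∷ T!) (there e∈T) (gc≡0 ∷ g≡0)
    with divDiff-isolated (λ x → g x * (ν x - ν c) ⁻¹) T T! e∈T
           (All.map (λ {x} gx≡0 x≢e → p≡0⇒p*q≡0 ((ν x - ν c) ⁻¹) (gx≡0 x≢e)) g≡0)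
  ... | ω , ω≢0 , eq = (ν e - ν c) ⁻¹ * ω , *-≢0 (⁻¹-≢0 (ν-≢ (c≢e ∘ sym))) ω≢0 , (begin
    g c * (nodeProduct c T) ⁻¹ + divDiff (λ x → g x * (ν x - ν c) ⁻¹) T
      ≡⟨ cong₂ _+_ (p≡0⇒p*q≡0 ((nodeProduct c T) ⁻¹) (gc≡0 c≢e)) eq ⟩
    0ℚ + g e * (ν e - ν c) ⁻¹ * ω
      ≡⟨ trans (+-identityˡ _) (*-assoc (g e) _ ω) ⟩
    g e * ((ν e - ν c) ⁻¹ * ω)  ∎)
    where
    open ≡-Reasoning
    c≢e : c ≢ e
    c≢e = All.lookup c∉T e∈T

  Grid : ℕ → Set
  Grid d = Fin d → List A

  infix 4 _∈ᵍ_
  _∈ᵍ_ : ∀ {d} → Vec A d → Grid d → Set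
  x ∈ᵍ S = ∀ i → lookup x i ∈ S i

  ∈ᵍ-∷ : ∀ {d y xs} {S : Grid (suc d)} → y ∈ S zero → xs ∈ᵍ S ∘ suc → y ∷ xs ∈ᵍ S
  ∈ᵍ-∷ y∈ xs∈ zero    = y∈
  ∈ᵍ-∷ y∈ xs∈ (suc i) = xs∈ i

  gridDivDiff : ∀ {d} → (Vec A d → ℚ) → Grid d → ℚ
  gridDivDiff {zero}  F S = F []
  gridDivDiff {suc d} F S = divDiff (λ y → gridDivDiff (F ∘ (y ∷_)) (S ∘ suc)) (S zero)

  gridDivDiff-isLinear : ∀ {d} (S : Grid d) → IsLinear (λ F → gridDivDiff F S)
  gridDivDiff-isLinear {zero}  S = record
    { cong-≗ = λ F≗G → F≗G []
    ; +-homo = λ _ _ → refl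
    ; *-homo = λ _ _ → refl
    }
  gridDivDiff-isLinear {suc d} S = record
    { cong-≗ = λ F≗G → divDiff-cong (S zero) (All.tabulate λ {y} _ → cong-≗ (λ xs → F≗G (y ∷ xs)))
    ; +-homo = λ F G → trans (divDiff-cong (S zero) (All.tabulate λ {y} _ → +-homo (F ∘ (y ∷_)) (G ∘ (y ∷_))))
                             (divDiff-+ _ _ (S zero))
    ; *-homo = λ a F → trans (divDiff-cong (S zero) (All.tabulate λ {y} _ → *-homo a (F ∘ (y ∷_))))
                             (divDiff-* a _ (S zero))
    }
    where open IsLinear (gridDivDiff-isLinear (S ∘ suc))

  gridDivDiff-vanishing : ∀ {d} (S : Grid d) {F} → (∀ x → x ∈ᵍ S → F x ≡ 0ℚ) → gridDivDiff F S ≡ 0ℚ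
  gridDivDiff-vanishing {zero}  S F≡0 = F≡0 [] (λ ())
  gridDivDiff-vanishing {suc d} S F≡0 = divDiff-vanishing (S zero) (All.tabulate λ y∈ →
    gridDivDiff-vanishing (S ∘ suc) (λ xs xs∈ → F≡0 _ (∈ᵍ-∷ y∈ xs∈)))

  gridDivDiff-isolated : ∀ {d} (S : Grid d) F {e} → (∀ i → Unique (S i)) → e ∈ᵍ S →
                         (∀ x → x ∈ᵍ S → x ≢ e → F x ≡ 0ℚ) →
                         ∃ λ Ω → Ω ≢ 0ℚ × gridDivDiff F S ≡ F e * Ω
  gridDivDiff-isolated {zero}  S F {[]}     _  _  _   = 1ℚ , (λ ()) , sym (*-identityʳ (F []))
  gridDivDiff-isolated {suc d} S F {e ∷ es} S! e∈ F≡0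
    with gridDivDiff-isolated (S ∘ suc) (F ∘ (e ∷_)) (S! ∘ suc) (e∈ ∘ suc)
           (λ xs xs∈ xs≢es → F≡0 _ (∈ᵍ-∷ (e∈ zero) xs∈) (xs≢es ∘ Vec.∷-injectiveʳ))
  ... | Ω , Ω≢0 , eqΩ
    with divDiff-isolated (λ y → gridDivDiff (F ∘ (y ∷_)) (S ∘ suc)) (S zero) (S! zero) (e∈ zero)
           (All.tabulate λ y∈ y≢e → gridDivDiff-vanishing (S ∘ suc) (λ xs xs∈ → F≡0 _ (∈ᵍ-∷ y∈ xs∈) (y≢e ∘ Vec.∷-injectiveˡ)))
  ... | ω , ω≢0 , eqω = Ω * ω , *-≢0 Ω≢0 ω≢0 , trans eqω (trans (cong (_* ω) eqΩ) (*-assoc (F (e ∷ es)) Ω ω))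

  gridDivDiff-isolated-≡0 : ∀ {d} (S : Grid d) F {e} → (∀ i → Unique (S i)) → e ∈ᵍ S →
                            (∀ x → x ∈ᵍ S → x ≢ e → F x ≡ 0ℚ) → gridDivDiff F S ≡ 0ℚ → F e ≡ 0ℚ
  gridDivDiff-isolated-≡0 S F S! e∈ F≡0 ΔF≡0 with gridDivDiff-isolated S F S! e∈ F≡0
  ... | Ω , Ω≢0 , eq = *-cancelˡ-≡0 Ω≢0 (trans (*-comm Ω _) (trans (sym eq) ΔF≡0))

  monomial : ∀ {d} → (Fin d → ℕ) → Vec A d → ℚ
  monomial b []       = 1ℚ
  monomial b (x ∷ xs) = ν x ^ b zero * monomial (b ∘ suc) xs

  gridDivDiff-monomial : ∀ {d} (b : Fin (suc d) → ℕ) S →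
    gridDivDiff (monomial b) S ≡ divDiff (λ y → ν y ^ b zero) (S zero) * gridDivDiff (monomial (b ∘ suc)) (S ∘ suc)
  gridDivDiff-monomial b S = begin
    divDiff (λ y → gridDivDiff (λ xs → ν y ^ b zero * monomial (b ∘ suc) xs) (S ∘ suc)) (S zero)
      ≡⟨ divDiff-cong (S zero) (All.tabulate λ {y} _ → trans (*-homo (ν y ^ b zero) (monomial (b ∘ suc))) (*-comm _ M)) ⟩
    divDiff (λ y → M * ν y ^ b zero) (S zero)
      ≡⟨ divDiff-* M (λ y → ν y ^ b zero) (S zero) ⟩
    M * divDiff (λ y → ν y ^ b zero) (S zero)
      ≡⟨ *-comm M _ ⟩
    divDiff (λ y → ν y ^ b zero) (S zero) * M  ∎
    where
    open ≡-Reasoning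
    open IsLinear (gridDivDiff-isLinear (S ∘ suc))
    M = gridDivDiff (monomial (b ∘ suc)) (S ∘ suc)

  gridDivDiff-monomial-vanishes : ∀ {d} (b : Fin d → ℕ) S → (∀ i → Unique (S i)) →
    ∀ i → suc (b i) < length (S i) → gridDivDiff (monomial b) S ≡ 0ℚ
  gridDivDiff-monomial-vanishes b S S! zero    b+1<|S| =
    trans (gridDivDiff-monomial b S)
          (p≡0⇒p*q≡0 _ (divDiff-^-vanishes (b zero) (S zero) (S! zero) b+1<|S|))
  gridDivDiff-monomial-vanishes b S S! (suc i) b+1<|S| =
    trans (gridDivDiff-monomial b S)
          (trans (cong (divDiff (λ y → ν y ^ b zero) (S zero) *_)
                       (gridDivDiff-monomial-vanishes (b ∘ suc) (S ∘ suc) (S! ∘ suc) i b+1<|S|))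
                 (*-zeroʳ (divDiff (λ y → ν y ^ b zero) (S zero))))

  gridDivDiff-monomial-leading : ∀ {d} (b : Fin d → ℕ) S → (∀ i → Unique (S i)) →
    (∀ i → length (S i) ≡ suc (b i)) → gridDivDiff (monomial b) S ≡ 1ℚ
  gridDivDiff-monomial-leading {zero}  b S S! |S|≡b+1 = refl
  gridDivDiff-monomial-leading {suc d} b S S! |S|≡b+1 =
    trans (gridDivDiff-monomial b S)
          (cong₂ _*_ (divDiff-^-leading (b zero) (S zero) (S! zero) (|S|≡b+1 zero))
                     (gridDivDiff-monomial-leading (b ∘ suc) (S ∘ suc) (S! ∘ suc) (|S|≡b+1 ∘ suc)))

∑-vanishing : ∀ {k} (f : Fin k → ℚ) → (∀ j → f j ≡ 0ℚ) → ∑[ j < k ] f j ≡ 0ℚ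
∑-vanishing {k} f f≡0 = trans (sum-cong-≗ f≡0) (sum-replicate-zero k)

∑-single : ∀ {k} (f : Fin k → ℚ) j → (∀ i → i ≢ j → f i ≡ 0ℚ) → ∑[ i < k ] f i ≡ f j
∑-single {suc _} f j f≡0 = trans (sum-remove {i = j} f)
  (trans (cong (f j +_) (∑-vanishing _ (λ i → f≡0 _ (Fin.punchInᵢ≢i j i)))) (+-identityʳ (f j)))

infix 7 _·_
_·_ : ∀ {k} → (Fin k → ℚ) → (Fin k → ℚ) → ℚ
_·_ {k} c a = ∑[ j < k ] (c j * a j)

·-linearʳ : ∀ {k} (c u v : Fin k → ℚ) r → c · (λ j → u j - r * v j) ≡ c · u - r * (c · v)
·-linearʳ {k} c u v r = begin
  ∑[ j < k ] (c j * (u j - r * v j))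
    ≡⟨ sum-cong-≗ (λ j → solve 4 (λ c u v r → c :* (u :- r :* v) := c :* u :+ (:- r) :* (c :* v)) refl (c j) (u j) (v j) r) ⟩
  ∑[ j < k ] (c j * u j + - r * (c j * v j))
    ≡⟨ ∑-distrib-+ (λ j → c j * u j) (λ j → - r * (c j * v j)) ⟩
  c · u + ∑[ j < k ] (- r * (c j * v j))
    ≡⟨ cong (c · u +_) (sym (*-distribˡ-sum (- r) (λ j → c j * v j))) ⟩
  c · u + - r * (c · v)
    ≡⟨ solve 3 (λ x r y → x :+ (:- r) :* y := x :- r :* y) refl (c · u) r (c · v) ⟩
  c · u - r * (c · v)  ∎
  where open ≡-Reasoning

NonTrivial : ∀ {k} → (Fin k → ℚ) → Set
NonTrivial c = ∃ λ j → c j ≢ 0ℚ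

Solves : ∀ {k} → (Fin k → ℚ) → List (Fin k → ℚ) → Set
Solves c rows = All (λ a → c · a ≡ 0ℚ) rows

-- Gaussian elimination of the first unknown, with a pivot row p such that p zero ≢ 0.
eliminateWith : ∀ {k} → (p a : Fin (suc k) → ℚ) → Fin k → ℚ
eliminateWith p a j = a (suc j) - (a zero * p zero ⁻¹) * p (suc j)

backSubstitute : ∀ {k} → (p : Fin (suc k) → ℚ) → (Fin k → ℚ) → Fin (suc k) → ℚ
backSubstitute p c′ zero    = - (p zero ⁻¹ * (c′ · (p ∘ suc)))
backSubstitute p c′ (suc j) = c′ j

backSubstitute-· : ∀ {k} p c′ (a : Fin (suc k) → ℚ) → backSubstitute p c′ · a ≡ c′ · eliminateWith p a
backSubstitute-· p c′ a = begin
  - (p zero ⁻¹ * D) * a zero + c′ · (a ∘ suc)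
    ≡⟨ solve 4 (λ i d a₀ x → :- (i :* d) :* a₀ :+ x := x :- (a₀ :* i) :* d) refl (p zero ⁻¹) D (a zero) (c′ · (a ∘ suc)) ⟩
  c′ · (a ∘ suc) - (a zero * p zero ⁻¹) * D
    ≡⟨ sym (·-linearʳ c′ (a ∘ suc) (p ∘ suc) (a zero * p zero ⁻¹)) ⟩
  c′ · eliminateWith p a  ∎
  where
  open ≡-Reasoning
  D = c′ · (p ∘ suc)

backSubstitute-pivot : ∀ {k} p (c′ : Fin k → ℚ) → p zero ≢ 0ℚ → backSubstitute p c′ · p ≡ 0ℚ
backSubstitute-pivot p c′ p₀≢0 = begin
  - (p zero ⁻¹ * D) * p zero + D  ≡⟨ solve 3 (λ i d p₀ → :- (i :* d) :* p₀ :+ d := d :- (p₀ :* i) :* d) refl (p zero ⁻¹) D (p zero) ⟩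
  D - p zero * p zero ⁻¹ * D      ≡⟨ cong (λ t → D - t * D) (⁻¹-inverseʳ p₀≢0) ⟩
  D - 1ℚ * D                      ≡⟨ solve 1 (λ d → d :- con 1ℚ :* d := con 0ℚ) refl D ⟩
  0ℚ                              ∎
  where
  open ≡-Reasoning
  D = c′ · (p ∘ suc)

homogeneous-nonTrivialSolution : ∀ k (rows : List (Fin k → ℚ)) → length rows < k →
                                 ∃ λ c → NonTrivial c × Solves c rows
homogeneous-nonTrivialSolution (suc k) rows |rows|<1+k with all? (λ a → a zero ≟ 0ℚ) rows
... | yes a₀≡0 = e₀ , (zero , 1≢0) , All.map (λ {a} → e₀-solves {a}) a₀≡0
  where
  e₀ : Fin (suc k) → ℚ
  e₀ zero    = 1ℚ
  e₀ (suc _) = 0ℚ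
  e₀-solves : ∀ {a} → a zero ≡ 0ℚ → e₀ · a ≡ 0ℚ
  e₀-solves {a} a₀≡0 =
    trans (cong₂ _+_ (trans (*-identityˡ (a zero)) a₀≡0) (∑-vanishing _ λ j → *-zeroˡ (a (suc j)))) (+-identityˡ 0ℚ)
... | no ¬a₀≡0 with find (¬All⇒Any¬ (λ a → a zero ≟ 0ℚ) rows ¬a₀≡0)
...   | p , p∈rows , p₀≢0 with ∈.∈-∃++ p∈rows
...     | pre , post , refl with homogeneous-nonTrivialSolution k (List.map (eliminateWith p) (pre ++ post)) |reduced|<k
  where
  |reduced|<k : length (List.map (eliminateWith p) (pre ++ post)) < k
  |reduced|<k rewrite List.length-map (eliminateWith p) (pre ++ post) | List.length-++ pre {post}
                    | List.length-++ pre {p ∷ post} | ℕ.+-suc (length pre) (length post) = ℕ.≤-pred |rows|<1+k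
...       | c′ , (j , c′ⱼ≢0) , c′-solves =
  backSubstitute p c′ , (suc j , c′ⱼ≢0) ,
  ++⁺ (lift pre-solved) (backSubstitute-pivot p c′ p₀≢0 ∷ lift post-solved)
  where
  pre-post-solved = ++⁻ pre (map⁻ c′-solves)
  pre-solved  = proj₁ pre-post-solved
  post-solved = proj₂ pre-post-solved
  lift : ∀ {as} → All (λ a → c′ · eliminateWith p a ≡ 0ℚ) as → Solves (backSubstitute p c′) as
  lift = All.map (λ {a} → trans (backSubstitute-· p c′ a))

elements : ∀ {n} → Subset n → List (Fin n)
elements []          = []
elements (true ∷ s)  = zero ∷ List.map suc (elements s)
elements (false ∷ s) = List.map suc (elements s)

length-elements : ∀ {n} (s : Subset n) → length (elements s) ≡ ∣ s ∣
length-elements []          = refl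
length-elements (true ∷ s)  = cong suc (trans (List.length-map suc (elements s)) (length-elements s))
length-elements (false ∷ s) = trans (List.length-map suc (elements s)) (length-elements s)

∈-elements⁺ : ∀ {n} (s : Subset n) {x} → x Subset.∈ s → x ∈ elements s
∈-elements⁺ (true ∷ s)  Vec.here      = here refl
∈-elements⁺ (true ∷ s)  (Vec.there x∈) = there (∈.∈-map⁺ suc (∈-elements⁺ s x∈))
∈-elements⁺ (false ∷ s) (Vec.there x∈) = ∈.∈-map⁺ suc (∈-elements⁺ s x∈)

∈-elements⁻ : ∀ {n} (s : Subset n) {x} → x ∈ elements s → x Subset.∈ s
∈-elements⁻ (true ∷ s) (here refl) = Vec.here
∈-elements⁻ (true ∷ s) (there x∈) with ∈.∈-map⁻ suc x∈
... | _ , y∈ , refl = Vec.there (∈-elements⁻ s y∈)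
∈-elements⁻ (false ∷ s) x∈ with ∈.∈-map⁻ suc x∈
... | _ , y∈ , refl = Vec.there (∈-elements⁻ s y∈)

elements-unique : ∀ {n} (s : Subset n) → Unique (elements s)
elements-unique []          = []
elements-unique (true ∷ s)  = All.tabulate (λ y∈ → zero≢suc y∈) ∷ Unique.map⁺ Fin.suc-injective (elements-unique s)
  where
  zero≢suc : ∀ {y} → y ∈ List.map suc (elements s) → zero ≢ y
  zero≢suc y∈ refl with ∈.∈-map⁻ suc y∈
  ... | _ , _ , ()
elements-unique (false ∷ s) = Unique.map⁺ Fin.suc-injective (elements-unique s)

atMost : ∀ {n} → Fin n → List (Fin n)
atMost y = tabulate {n = suc (toℕ y)} (λ i → inject≤ i (Fin.toℕ<n y))

length-atMost : ∀ {n} (y : Fin n) → length (atMost y) ≡ suc (toℕ y)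
length-atMost y = List.length-tabulate (λ i → inject≤ i (Fin.toℕ<n y))

atMost-unique : ∀ {n} (y : Fin n) → Unique (atMost y)
atMost-unique y = Unique.tabulate⁺ {f = λ i → inject≤ i (Fin.toℕ<n y)} (Fin.inject≤-injective _ _ _ _)

∈-allTuples : ∀ n d (x : Tuple n d) → x ∈ allTuples n d
∈-allTuples n zero    []       = here refl
∈-allTuples n (suc d) (x ∷ xs) =
  ∈.∈-concat⁺′ (∈.∈-map⁺ (x ∷_) (∈-allTuples n d xs)) (∈.∈-map⁺ (λ y → List.map (y ∷_) (allTuples n d)) (∈.∈-allFin x))

allTuples-unique : ∀ n d → Unique (allTuples n d)
allTuples-unique n zero    = [] ∷ []
allTuples-unique n (suc d) =
  subst Unique (sym (concatMap-map≡cartesianProductWith (allFin n) (allTuples n d)))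
        (Unique.cartesianProductWith⁺ _∷_ (λ eq → Vec.∷-injective eq) (Unique.allFin⁺ n) (allTuples-unique n d))
  where
  concatMap-map≡cartesianProductWith : ∀ {A B C : Set} {f : A → B → C} xs ys →
    List.concatMap (λ x → List.map (f x) ys) xs ≡ cartesianProductWith f xs ys
  concatMap-map≡cartesianProductWith []       ys = refl
  concatMap-map≡cartesianProductWith (x ∷ xs) ys = cong (List.map _ ys ++_) (concatMap-map≡cartesianProductWith xs ys)

lookup-injective : ∀ {A : Set} {xs : List A} → Unique xs → ∀ {i j} → List.lookup xs i ≡ List.lookup xs j → i ≡ j
lookup-injective (_ ∷ _)         {zero}  {zero}  _  = refl
lookup-injective (x∉xs ∷ _)      {zero}  {suc j} eq = ⊥-elim (All.lookup x∉xs (∈.∈-lookup j) eq)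
lookup-injective (x∉xs ∷ _)      {suc i} {zero}  eq = ⊥-elim (All.lookup x∉xs (∈.∈-lookup i) (sym eq))
lookup-injective (_ ∷ xs!)       {suc i} {suc j} eq = cong suc (lookup-injective xs! eq)

All-prefix-induction : ∀ {A : Set} (Q : A → Set) (xs : List A) →
  (∀ ys e zs → xs ≡ ys ++ e ∷ zs → All Q ys → Q e) → All Q xs
All-prefix-induction Q xs step = go [] xs refl []
  where
  go : ∀ ys zs → xs ≡ ys ++ zs → All Q ys → All Q xs
  go ys []       xs≡ys   Qys = subst (All Q) (sym (trans xs≡ys (List.++-identityʳ ys))) Qys
  go ys (e ∷ zs) xs≡ys++ Qys =
    go (ys ++ [ e ]) zs (trans xs≡ys++ (sym (List.++-assoc ys [ e ] zs))) (++⁺ Qys (step ys e zs xs≡ys++ Qys ∷ []))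

∃-maximal : ∀ {k} (P : Fin k → Set) → Decidable P → (w : Fin k → ℕ) → ∃ P →
            ∃ λ j → P j × (∀ j′ → P j′ → w j′ ≤ w j)
∃-maximal {suc k} P P? w (j₀ , Pj₀) with Fin.any? (P? ∘ suc)
... | no ¬P∘suc = zero , P-zero j₀ Pj₀ , λ { zero _ → ℕ.≤-refl ; (suc j) Pj → ⊥-elim (¬P∘suc (j , Pj)) }
  where
  P-zero : ∀ j → P j → P zero
  P-zero zero    Pj = Pj
  P-zero (suc j) Pj = ⊥-elim (¬P∘suc (j , Pj))
... | yes ∃P∘suc with ∃-maximal (P ∘ suc) (P? ∘ suc) (w ∘ suc) ∃P∘suc | P? zero
...   | j , Pj , max | no ¬P₀ = suc j , Pj , λ { zero P₀ → ⊥-elim (¬P₀ P₀) ; (suc j′) Pj′ → max j′ Pj′ }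
...   | j , Pj , max | yes P₀ with ℕ.≤-total (w zero) (w (suc j))
...     | inj₁ w₀≤ = suc j , Pj , λ { zero _ → w₀≤ ; (suc j′) Pj′ → max j′ Pj′ }
...     | inj₂ ≤w₀ = zero , P₀ , λ { zero _ → ℕ.≤-refl ; (suc j′) Pj′ → ℕ.≤-trans (max j′ Pj′) ≤w₀ }

degree : ∀ {d} → (Fin d → ℕ) → ℕ
degree {zero}  a = 0
degree {suc d} a = a zero ℕ.+ degree (a ∘ suc)

degree-mono : ∀ {d} (a b : Fin d → ℕ) → (∀ i → a i ≤ b i) → degree a ≤ degree b
degree-mono {zero}  a b a≤b = z≤n
degree-mono {suc d} a b a≤b = ℕ.+-mono-≤ (a≤b zero) (degree-mono (a ∘ suc) (b ∘ suc) (a≤b ∘ suc))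

≤-degree-≡ : ∀ {d} (a b : Fin d → ℕ) → (∀ i → a i ≤ b i) → degree b ≤ degree a → ∀ i → a i ≡ b i
≤-degree-≡ a b a≤b ∂b≤∂a zero    = ℕ.≤-antisym (a≤b zero)
  (ℕ.+-cancelʳ-≤ (degree (b ∘ suc)) (b zero) (a zero)
    (ℕ.≤-trans ∂b≤∂a (ℕ.+-monoʳ-≤ (a zero) (degree-mono (a ∘ suc) (b ∘ suc) (a≤b ∘ suc)))))
≤-degree-≡ a b a≤b ∂b≤∂a (suc i) = ≤-degree-≡ (a ∘ suc) (b ∘ suc) (a≤b ∘ suc)
  (ℕ.+-cancelˡ-≤ (b zero) (degree (b ∘ suc)) (degree (a ∘ suc))
    (ℕ.≤-trans ∂b≤∂a (ℕ.+-monoˡ-≤ (degree (a ∘ suc)) (a≤b zero)))) i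

∃-smaller-coordinate : ∀ {d} (a b : Fin d → ℕ) → degree a ≤ degree b → ¬ (∀ i → a i ≡ b i) → ∃ λ i → a i < b i
∃-smaller-coordinate {d} a b ∂a≤∂b a≢b with Fin.¬∀⟶∃¬ d (λ i → b i ≤ a i) (λ i → b i ≤? a i)
                                                   (λ b≤a → a≢b (λ i → sym (≤-degree-≡ b a b≤a ∂a≤∂b i)))
... | i , b≰a = i , ℕ.≰⇒> b≰a

allGeq-lookup : ∀ (ys qs : List ℕ) → length ys ≡ length qs →
  (∀ i j → toℕ i ≡ toℕ j → List.lookup qs j ≤ List.lookup ys i) → allGeq ys qs ≡ true
allGeq-lookup []       []       _          _      = refl
allGeq-lookup (y ∷ ys) (q ∷ qs) |ys|≡|qs| qs≤ys with q ≤ᵇ y | ℕ.≤⇒≤ᵇ (qs≤ys zero zero refl)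
... | true | _ = allGeq-lookup ys qs (ℕ.suc-injective |ys|≡|qs|) (λ i j i≡j → qs≤ys (suc i) (suc j) (cong suc i≡j))

lookup-toList : ∀ {A : Set} {d} (v : Vec A d) i j → toℕ i ≡ toℕ j → List.lookup (toList v) i ≡ Vec.lookup v j
lookup-toList (x ∷ v) zero    zero    _   = refl
lookup-toList (x ∷ v) (suc i) (suc j) i≡j = lookup-toList v i j (ℕ.suc-injective i≡j)

permutation-injective : ∀ {m n} (π : Permutation m n) {x y} → π ⟨$⟩ʳ x ≡ π ⟨$⟩ʳ y → x ≡ y
permutation-injective π {x} {y} eq = trans (sym (inverseˡ π)) (trans (cong (π ⟨$⟩ˡ_) eq) (inverseˡ π))

-- For each rank m, injectivity of ρ = π ∘ σ gives some k ≤ m with m ≤ ρ k, whence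
-- p_m ≤ p_(ρ k) ≤ v_(σ k) = ys_k ≤ ys_m.
sort-dominates : ∀ {d} (p : Vec ℕ d) → (∀ i j → i ≤ᶠ j → Vec.lookup p i ≤ Vec.lookup p j) →
  (π : Permutation′ d) (v : Vec ℕ d) → (∀ i → Vec.lookup p (π ⟨$⟩ʳ i) ≤ Vec.lookup v i) →
  allGeq (sort (toList v)) (toList p) ≡ true
sort-dominates {d} p p-mono π v p∘π≤v =
  allGeq-lookup ys (toList p) (trans |ys|≡d (sym (Vec.length-toList p))) p≤ys
  where
  xs = toList v
  ys = sort xs
  ys↭xs = ↭⇒↭ₛ (sort-↭ xs)
  σ : Permutation (length ys) (length xs)
  σ = Perm.onIndices ys↭xs
  |xs|≡d : length xs ≡ d
  |xs|≡d = Vec.length-toList v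
  |ys|≡d : length ys ≡ d
  |ys|≡d = trans (Perm.xs↭ys⇒|xs|≡|ys| (≡.setoid ℕ) ys↭xs) |xs|≡d
  ρ : Fin (length ys) → Fin d
  ρ k = π ⟨$⟩ʳ cast |xs|≡d (σ ⟨$⟩ʳ k)
  ρ-injective : ∀ {a b} → ρ a ≡ ρ b → a ≡ b
  ρ-injective {a} {b} eq = permutation-injective σ (Fin.toℕ-injective (begin
    toℕ (σ ⟨$⟩ʳ a)                ≡⟨ sym (Fin.toℕ-cast |xs|≡d (σ ⟨$⟩ʳ a)) ⟩
    toℕ (cast |xs|≡d (σ ⟨$⟩ʳ a))  ≡⟨ cong toℕ (permutation-injective π eq) ⟩
    toℕ (cast |xs|≡d (σ ⟨$⟩ʳ b))  ≡⟨ Fin.toℕ-cast |xs|≡d (σ ⟨$⟩ʳ b) ⟩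
    toℕ (σ ⟨$⟩ʳ b)                ∎))
    where open ≡-Reasoning
  p≤ys : ∀ m j → toℕ m ≡ toℕ j → List.lookup (toList p) j ≤ List.lookup ys m
  p≤ys m j m≡j with Fin.injective⇒existsPivot ρ-injective m
  ... | k , k≤m , m≤ρk = begin
    List.lookup (toList p) j      ≡⟨ lookup-toList p j m′ (trans (sym m≡j) (sym (Fin.toℕ-cast |ys|≡d m))) ⟩
    Vec.lookup p m′               ≤⟨ p-mono m′ (ρ k) (subst (_≤ toℕ (ρ k)) (sym (Fin.toℕ-cast |ys|≡d m)) m≤ρk) ⟩
    Vec.lookup p (ρ k)            ≤⟨ p∘π≤v (cast |xs|≡d (σ ⟨$⟩ʳ k)) ⟩
    Vec.lookup v (cast |xs|≡d (σ ⟨$⟩ʳ k)) ≡⟨ sym (lookup-toList v (σ ⟨$⟩ʳ k) _ (sym (Fin.toℕ-cast |xs|≡d (σ ⟨$⟩ʳ k)))) ⟩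
    List.lookup xs (σ ⟨$⟩ʳ k)     ≡⟨ sym (Perm.onIndices-lookup (≡.setoid ℕ) ys↭xs k) ⟩
    List.lookup ys k              ≤⟨ lookup-mono-≤ (DecTotalOrder.totalOrder ≤-decTotalOrder) (sort-↗ xs) k≤m ⟩
    List.lookup ys m              ∎
    where
    open ℕ.≤-Reasoning
    m′ = cast |ys|≡d m

G0-edge⇒∃-small : ∀ {n d} (p : Vec ℕ d) → (∀ i j → i ≤ᶠ j → Vec.lookup p i ≤ Vec.lookup p j) →
  (x : Vec (Fin n) d) → G0 p x ≡ true →
  (π : Permutation′ d) → ∃ λ i → label (Vec.lookup x i) < Vec.lookup p (π ⟨$⟩ʳ i)
G0-edge⇒∃-small {d = d} p p-mono x x∈G0 π
  with Fin.¬∀⟶∃¬ d (λ i → Vec.lookup p (π ⟨$⟩ʳ i) ≤ Vec.lookup (Vec.map label x) i) (λ i → _ ≤? _) x∉G0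
  where
  x∉G0 : ¬ (∀ i → Vec.lookup p (π ⟨$⟩ʳ i) ≤ Vec.lookup (Vec.map label x) i)
  x∉G0 p∘π≤x with () ← trans (sym x∈G0) (cong not (sort-dominates p p-mono π (Vec.map label x) p∘π≤x))
... | i , p≰x = i , subst (_< _) (Vec.lookup-map i label x) (ℕ.≰⇒> p≰x)

weaklySaturated-closure : ∀ {n d} {p : Vec ℕ d} {H : Hypergraph n d} → WeaklySaturated p H →
  (Z : Tuple n d → Set) → (∀ x → H x ≡ true → Z x) →
  (∀ {E} e → CopyContaining p E e → (∀ x → E x → x ≢ e → Z x) → Z e) →
  ∀ x → Z x
weaklySaturated-closure {H = H} (L , _ , L⇔non-edge , step) Z Z-edges Z-closed x with H x in Hx
... | true  = Z-edges x Hx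
... | false = All.lookup Z-L (Equivalence.from (L⇔non-edge x) Hx)
  where
  Z-L : All Z L
  Z-L = All-prefix-induction Z L λ ys e zs L≡ Z-ys → Z-closed e (step ys e zs L≡) λ where
    x (inj₁ Hx)          _   → Z-edges x Hx
    x (inj₂ (here refl)) x≢e → ⊥-elim (x≢e refl)
    x (inj₂ (there x∈ys)) _  → All.lookup Z-ys x∈ys

ℕ→ℚ : ℕ → ℚ
ℕ→ℚ m = mkℚ (ℤ.+ m) 0 (Coprime.sym (Coprime.1-coprimeTo m))

toℚ : ∀ {n} → Fin n → ℚ
toℚ = ℕ→ℚ ∘ toℕ

toℚ-injective : ∀ {n} {x y : Fin n} → toℚ x ≡ toℚ y → x ≡ y
toℚ-injective = Fin.toℕ-injective ∘ ℤ.+-injective ∘ cong ↥_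

exponent : ∀ {n d} → Tuple n d → Fin d → ℕ
exponent x i = toℕ (lookup x i)

exponent-injective : ∀ {n d} {x y : Tuple n d} → (∀ i → exponent x i ≡ exponent y i) → x ≡ y
exponent-injective {x = x} {y} x≗y = trans (sym (Vec.tabulate∘lookup x))
  (trans (Vec.tabulate-cong (Fin.toℕ-injective ∘ x≗y)) (Vec.tabulate∘lookup y))

module _ {n d : ℕ} where

  open DividedDifferences (toℚ {n}) toℚ-injective

  polynomial : ∀ {k} → (Fin k → Tuple n d) → (Fin k → ℚ) → Tuple n d → ℚ
  polynomial {k} t c x = ∑[ j < k ] (c j * monomial (exponent (t j)) x)

  gridDivDiff-polynomial : ∀ {k} (t : Fin k → Tuple n d) c S →
    gridDivDiff (polynomial t c) S ≡ ∑[ j < k ] (c j * gridDivDiff (monomial (exponent (t j))) S)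
  gridDivDiff-polynomial t c S = IsLinear.∑-homo (gridDivDiff-isLinear S) c (monomial ∘ exponent ∘ t)

  -- As label = exponent + 1,
  -- G0-edge⇒∃-small says that every monomial of G0 has degree below p_(π i) − 1 in some
  -- coordinate i, so the grid annihilates it.
  polynomial-copy-closed : ∀ {k} (p : Vec ℕ d) → (∀ i j → i Fin.≤ j → lookup p i ≤ lookup p j) →
    (t : Fin k → Tuple n d) → (∀ j → G0 p (t j) ≡ true) → (c : Fin k → ℚ) →
    ∀ {E} e → CopyContaining p E e → (∀ x → E x → x ≢ e → polynomial t c x ≡ 0ℚ) → polynomial t c e ≡ 0ℚ
  polynomial-copy-closed p p-mono t t∈G0 c e (π , S , |S|≡p∘π , S⊆E , e∈S) f≡0 =
    gridDivDiff-isolated-≡0 grid (polynomial t c) (elements-unique ∘ S) (λ i → ∈-elements⁺ (S i) (e∈S i))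
      (λ x x∈grid → f≡0 x (S⊆E x (λ i → ∈-elements⁻ (S i) (x∈grid i))))
      (trans (gridDivDiff-polynomial t c grid) (∑-vanishing _ λ j → trans (cong (c j *_) (monomial-vanishes j)) (*-zeroʳ (c j))))
    where
    grid : Grid d
    grid = elements ∘ S
    monomial-vanishes : ∀ j → gridDivDiff (monomial (exponent (t j))) grid ≡ 0ℚ
    monomial-vanishes j with G0-edge⇒∃-small p p-mono (t j) (t∈G0 j) π
    ... | i , small = gridDivDiff-monomial-vanishes (exponent (t j)) grid (elements-unique ∘ S) i
      (subst (label (lookup (t j) i) <_) (sym (trans (length-elements (S i)) (|S|≡p∘π i))) small)

  -- Among the nonzero coefficients take one of maximal degree; the grid of initial segments
  -- just large enough for its monomial annihilates every other monomial in the support.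
  monomials-independent : ∀ {k} (t : Fin k → Tuple n d) → (∀ {i j} → t i ≡ t j → i ≡ j) → (c : Fin k → ℚ) →
    (∀ x → polynomial t c x ≡ 0ℚ) → ∀ j → c j ≡ 0ℚ
  monomials-independent t t-injective c f≡0 j with c j ≟ 0ℚ
  ... | yes cⱼ≡0 = cⱼ≡0
  ... | no cⱼ≢0 with ∃-maximal (λ j → c j ≢ 0ℚ) (λ j → ¬? (c j ≟ 0ℚ)) (degree ∘ exponent ∘ t) (j , cⱼ≢0)
  ...   | j* , c*≢0 , maximal = ⊥-elim (c*≢0 (begin
    c j*                                     ≡⟨ sym (*-identityʳ (c j*)) ⟩
    c j* * 1ℚ                                ≡⟨ cong (c j* *_) (sym (gridDivDiff-monomial-leading (exponent (t j*)) grid grid-unique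
                                                  (λ i → length-atMost (lookup (t j*) i)))) ⟩
    c j* * gridDivDiff (M j*) grid           ≡⟨ sym (∑-single (λ j → c j * gridDivDiff (M j) grid) j* others-vanish) ⟩
    ∑[ j < _ ] (c j * gridDivDiff (M j) grid) ≡⟨ sym (gridDivDiff-polynomial t c grid) ⟩
    gridDivDiff (polynomial t c) grid        ≡⟨ gridDivDiff-vanishing grid (λ x _ → f≡0 x) ⟩
    0ℚ                                       ∎))
    where
    open ≡-Reasoning
    M = monomial ∘ exponent ∘ t
    grid : Grid d
    grid i = atMost (lookup (t j*) i)
    grid-unique : ∀ i → Unique (grid i)
    grid-unique i = atMost-unique (lookup (t j*) i)
    others-vanish : ∀ j → j ≢ j* → c j * gridDivDiff (M j) grid ≡ 0ℚ
    others-vanish j j≢j* with c j ≟ 0ℚ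
    ... | yes cⱼ≡0 = p≡0⇒p*q≡0 _ cⱼ≡0
    ... | no cⱼ≢0
      with ∃-smaller-coordinate (exponent (t j)) (exponent (t j*)) (maximal j cⱼ≢0) (j≢j* ∘ t-injective ∘ exponent-injective)
    ...   | i , smaller = trans (cong (c j *_) (gridDivDiff-monomial-vanishes (exponent (t j)) grid grid-unique i
                                  (subst (suc (exponent (t j) i) <_) (sym (length-atMost (lookup (t j*) i))) (ℕ.s≤s smaller))))
                                (*-zeroʳ (c j))

  polynomial-vanishes-everywhere : ∀ {k} (p : Vec ℕ d) → (∀ i j → i Fin.≤ j → lookup p i ≤ lookup p j) →
    (t : Fin k → Tuple n d) → (∀ j → G0 p (t j) ≡ true) → (c : Fin k → ℚ) →
    ∀ {H} → WeaklySaturated p H → (∀ x → H x ≡ true → polynomial t c x ≡ 0ℚ) → ∀ x → polynomial t c x ≡ 0ℚ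
  polynomial-vanishes-everywhere p p-mono t t∈G0 c saturated f≡0-on-H =
    weaklySaturated-closure {p = p} saturated (λ x → polynomial t c x ≡ 0ℚ) f≡0-on-H (polynomial-copy-closed p p-mono t t∈G0 c)

  ∃-polynomial-vanishing-on-edges : ∀ {k} (H : Hypergraph n d) (t : Fin k → Tuple n d) → numEdges H < k →
    ∃ λ c → NonTrivial c × (∀ x → H x ≡ true → polynomial t c x ≡ 0ℚ)
  ∃-polynomial-vanishing-on-edges {k} H t |H|<k
    with homogeneous-nonTrivialSolution k (List.map row edges) (subst (_< k) (sym (List.length-map row edges)) |H|<k)
    where
    edges = filterᵇ H (allTuples n d)
    row : Tuple n d → Fin k → ℚ
    row x j = monomial (exponent (t j)) x
  ... | c , nonTrivial , solves = c , nonTrivial , λ x Hx →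
    All.lookup (map⁻ solves) (∈.∈-filter⁺ (T? ∘ H) (∈-allTuples n d x) (Equivalence.from T-≡ Hx))

G0-edge : ∀ n d (p : Vec ℕ d) → Fin (numEdges (G0 {n} p)) → Tuple n d
G0-edge n d p = List.lookup (filterᵇ (G0 p) (allTuples n d))

G0-edge-injective : ∀ n d p {i j} → G0-edge n d p i ≡ G0-edge n d p j → i ≡ j
G0-edge-injective n d p = lookup-injective (Unique.filter⁺ (T? ∘ G0 p) (allTuples-unique n d))

G0-edge∈G0 : ∀ n d p j → G0 p (G0-edge n d p j) ≡ true
G0-edge∈G0 n d p j = Equivalence.to T-≡ (proj₂ (∈.∈-filter⁻ (T? ∘ G0 p) {xs = allTuples n d} (∈.∈-lookup j)))

lemma2 : (n d : ℕ) (p : Vec ℕ d) → ValidParams n d p →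
         (H : Hypergraph n d) → WeaklySaturated p H →
         numEdges (G0 {n} p) ≤ numEdges H
lemma2 n d p (_ , _ , p-mono) H saturated with numEdges (G0 {n} p) ≤? numEdges H
... | yes |G0|≤|H| = |G0|≤|H|
... | no |G0|≰|H| with ∃-polynomial-vanishing-on-edges H (G0-edge n d p) (ℕ.≰⇒> |G0|≰|H|)
...   | c , (j , cⱼ≢0) , vanishes-on-H = ⊥-elim (cⱼ≢0 (monomials-independent (G0-edge n d p) (G0-edge-injective n d p) c
          (polynomial-vanishes-everywhere p p-mono (G0-edge n d p) (G0-edge∈G0 n d p) c saturated vanishes-on-H) j))
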